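{- Let $\alpha,\beta\in\mathcal D$. If $\alpha=\beta$ then $\alpha^-[\beta^+]\twoheadrightarrow\varepsilon$; otherwise $\alpha^-[\beta^+]\twoheadrightarrow0$.
   Context: Syntax of the $\partial_0\lambda$-calculus with tests. Terms $M ::= x \mid \lambda x.M \mid MP \mid \bar\tau(V)$, bags $P ::= [L_1,\dots,L_k]$, tests $V ::= \tau[L_1,\dots,L_k]$ ($k\ge 0$; finite multisets of terms, the tag $\tau$ distinguishes tests from bags), up to $\alpha$-equivalence. $\varepsilon:=\tau[\,]$; $V\mid W$ is multiset union of tests (empty parallel composition is $\varepsilon$). Sums are finite formal sums with idempotent addition, $0$ the empty sum; constructors extend multilinearly to sums and give $0$ on $0$. $A\{0/x\}=0$ if $x$ is free in $A$, else $A$. Linear substitution: $x\langle N/x\rangle=N$; $y\langle N/x\rangle=0$ ($y\ne x$); $(\lambda y.M)\langle N/x\rangle=\lambda y.M\langle N/x\rangle$; $(MP)\langle N/x\rangle=M\langle N/x\rangle P+M(P\langle N/x\rangle)$; $\bar\tau(V)\langle N/x\rangle=\bar\tau(V\langle N/x\rangle)$; $[L_1,\dots,L_k]\langle N/x\rangle=\sum_i[L_1,\dots,L_i\langle N/x\rangle,\dots,L_k]$, likewise for tests; $A\langle[L_1,\dots,L_k]/x\rangle:=A\langle L_1/x\rangle\cdots\langle L_k/x\rangle$. Reduction: $(\lambda x.M)P\to M\langle P/x\rangle\{0/x\}$; $\bar\tau(V)P\to\bar\tau(V)$ if $P=[\,]$, else $\to0$; $\tau[\lambda x.M]\mid V\to\tau[M\{0/x\}]\mid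 V$; $\tau[\bar\tau(V)]\mid W\to V\mid W$; $\to$ is the closure under all syntactic positions and under sums, $\twoheadrightarrow$ its reflexive-transitive closure. A test-context is a test with one hole $[\cdot]$ in term position; $C[M]$ replaces the hole by $M$. The set $\mathcal D$: $\mathcal M_f(S)$ = finite multisets over $S$; $D_0=\emptyset$, $D_{n+1}$ = $\mathbb N$-indexed sequences $(a_1,a_2,\dots)$ of elements of $\mathcal M_f(D_n)$ with all but finitely many empty; $\mathcal D=\bigcup_nD_n$; $a::(a_1,a_2,\dots):=(a,a_1,a_2,\dots)$; $*:=([\,],[\,],\dots)$. The length $\ell(\alpha)$ is $0$ if $\alpha=*$, otherwise the unique $r$ with $\alpha=a_1::\cdots::a_r::*$, $a_r\ne[\,]$. For $\alpha=[\alpha_{1,1},\dots,\alpha_{1,k_1}]::\cdots::[\alpha_{r,1},\dots,\alpha_{r,k_r}]::*$ with $r=\ell(\alpha)$, define by mutual (well-founded) induction the closed term $\alpha^+=\lambda x_1\dots x_r.\bar\tau\big(\|_{i=1}^r(\alpha_{i,1}^-[x_i]\mid\cdots\mid\alpha_{i,k_i}^-[x_i])\big)$ and the test-context $\alpha^-[\cdot]=\tau\big[[\cdot][\alpha_{1,1}^+,\dots,\alpha_{1,k_1}^+]\cdots[\alpha_{r,1}^+,\dots,\alpha_{r,k_r}^+]\big]$. -}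

module Defs where

open import Data.Nat using (ℕ; zero; suc; _∸_; _<ᵇ_; _≡ᵇ_)
open import Data.Bool using (Bool; true; false; if_then_else_; _∨_)
open import Data.List using (List; []; _∷_; _++_; map; concatMap; foldl)
open import Data.List.Relation.Unary.All using (All)
open import Data.List.Relation.Unary.Any using (Any)
open import Data.Product using (_×_)
open import Data.Sum using (_⊎_)
open import Relation.Binary.Construct.Closure.ReflexiveTransitive using (Star)

-- Syntax of the ∂₀λ-calculus with tests, with de Bruijn indices
-- (so terms are automatically taken up to α-equivalence).
-- Bags and tests are finite multisets of terms, represented by lists
-- taken up to permutation (see _≃ᴸ_ below).

data Term : Set where
  var : ℕ → Term
  lam : Term → Term
  app : Term → List Term → Term
  tst : List Term → Term         -- τ̄(V) (V a test)

Bag : Set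
Bag = List Term

-- a test τ[L₁,…,Lₖ] is represented by its list of elements
Test : Set
Test = List Term

ε : Test
ε = []

_∣_ : Test → Test → Test
V ∣ W = V ++ W

-- Finite formal sums (idempotent addition) are lists taken up to
-- set-equality modulo term equivalence; 0 is [].

mutual
  data _≃_ : Term → Term → Set where
    var : ∀ {n} → var n ≃ var n
    lam : ∀ {M N} → M ≃ N → lam M ≃ lam N
    app : ∀ {M N P Q} → M ≃ N → P ≃ᴸ Q → app M P ≃ app N Q
    tst : ∀ {V W} → V ≃ᴸ W → tst V ≃ tst W

  data _≃ᴸ_ : List Term → List Term → Set where
    nil   : [] ≃ᴸ []
    cons  : ∀ {x y xs ys} → x ≃ y → xs ≃ᴸ ys → (x ∷ xs) ≃ᴸ (y ∷ ys)
    swap  : ∀ {x y xs} → (x ∷ y ∷ xs) ≃ᴸ (y ∷ x ∷ xs)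
    trans : ∀ {xs ys zs} → xs ≃ᴸ ys → ys ≃ᴸ zs → xs ≃ᴸ zs

_≈ₛ_ : List Test → List Test → Set
S ≈ₛ T = All (λ V → Any (λ W → V ≃ᴸ W) T) S × All (λ W → Any (λ V → W ≃ᴸ V) S) T

mutual
  shift : ℕ → Term → Term
  shift c (var y) = if y <ᵇ c then var y else var (suc y)
  shift c (lam M) = lam (shift (suc c) M)
  shift c (app M P) = app (shift c M) (shiftL c P)
  shift c (tst V) = tst (shiftL c V)

  shiftL : ℕ → List Term → List Term
  shiftL c [] = []
  shiftL c (L ∷ Ls) = shift c L ∷ shiftL c Ls

mutual
  occurs : ℕ → Term → Bool
  occurs x (var y) = y ≡ᵇ x
  occurs x (lam M) = occurs (suc x) M
  occurs x (app M P) = occurs x M ∨ occursL x P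
  occurs x (tst V) = occursL x V

  occursL : ℕ → List Term → Bool
  occursL x [] = false
  occursL x (L ∷ Ls) = occurs x L ∨ occursL x Ls

mutual
  lower : ℕ → Term → Term
  lower x (var y) = if y <ᵇ x then var y else var (y ∸ 1)
  lower x (lam M) = lam (lower (suc x) M)
  lower x (app M P) = app (lower x M) (lowerL x P)
  lower x (tst V) = tst (lowerL x V)

  lowerL : ℕ → List Term → List Term
  lowerL x [] = []
  lowerL x (L ∷ Ls) = lower x L ∷ lowerL x Ls

erase : ℕ → Term → List Term
erase x M = if occurs x M then [] else (lower x M ∷ [])

-- Linear substitution  M⟨N/x⟩  (N lives in the same context as M)

mutual
  lsub : ℕ → Term → Term → List Term
  lsub x N (var y) = if y ≡ᵇ x then N ∷ [] else []
  lsub x N (lam M) = map lam (lsub (suc x) (shift 0 N) M)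
  lsub x N (app M P) =
    map (λ M′ → app M′ P) (lsub x N M) ++ map (app M) (lsubL x N P)
  lsub x N (tst V) = map tst (lsubL x N V)

  lsubL : ℕ → Term → List Term → List (List Term)
  lsubL x N [] = []
  lsubL x N (L ∷ Ls) =
    map (λ L′ → L′ ∷ Ls) (lsub x N L) ++ map (λ Ls′ → L ∷ Ls′) (lsubL x N Ls)

lsubBag : ℕ → Bag → Term → List Term
lsubBag x P M = foldl (λ S L → concatMap (lsub x L) S) (M ∷ []) P

-- contractum of (λx.M)P :  M⟨P/x⟩{0/x}
-- (P lives outside the binder, so it is weakened by one)
beta : Term → Bag → List Term
beta M P = concatMap (erase 0) (lsubBag 0 (shiftL 0 P) M)

mutual
  data _⟶_ : Term → List Term → Set where
    β      : ∀ {M P} → app (lam M) P ⟶ beta M P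
    τ̄-nil  : ∀ {V} → app (tst V) [] ⟶ (tst V ∷ [])
    τ̄-cons : ∀ {V L P} → app (tst V) (L ∷ P) ⟶ []
    c-lam  : ∀ {M S} → M ⟶ S → lam M ⟶ map lam S
    c-appL : ∀ {M S P} → M ⟶ S → app M P ⟶ map (λ M′ → app M′ P) S
    c-appR : ∀ {M L S} xs ys → L ⟶ S →
             app M (xs ++ L ∷ ys) ⟶ map (λ L′ → app M (xs ++ L′ ∷ ys)) S
    c-tst  : ∀ {V S} → V ⟶ᵗ S → tst V ⟶ map tst S

  data _⟶ᵗ_ : Test → List Test → Set where
    τλ    : ∀ {M} xs ys →
            (xs ++ lam M ∷ ys) ⟶ᵗ map (λ M′ → xs ++ M′ ∷ ys) (erase 0 M)
    ττ̄    : ∀ {V} xs ys → (xs ++ tst V ∷ ys) ⟶ᵗ ((V ∣ (xs ++ ys)) ∷ [])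
    c-el  : ∀ {L S} xs ys → L ⟶ S →
            (xs ++ L ∷ ys) ⟶ᵗ map (λ L′ → xs ++ L′ ∷ ys) S

data _⟶ₛ_ : List Test → List Test → Set where
  step : ∀ {V S} xs ys → V ⟶ᵗ S → (xs ++ V ∷ ys) ⟶ₛ (xs ++ S ++ ys)

_↠_ : List Test → List Test → Set
_↠_ = Star (λ S T → (S ⟶ₛ T) ⊎ (S ≈ₛ T))

-- The set 𝒟 : a finite list (a₁,…,aₙ) stands for a₁::⋯::aₙ::*,
-- each aᵢ a finite multiset (list up to permutation).  Inductivity
-- gives exactly ⋃ₙ Dₙ (with D₀ = ∅).

data D : Set where
  mk : List (List D) → D

-- i-th component of the sequence (0-based), [] beyond the list
nth : List (List D) → ℕ → List D
nth [] i = []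
nth (a ∷ as) zero = a
nth (a ∷ as) (suc i) = nth as i

mutual
  data _≐_ : D → D → Set where
    mk : ∀ {as bs} → (∀ i → nth as i ≈ᴹ nth bs i) → mk as ≐ mk bs

  data _≈ᴹ_ : List D → List D → Set where
    nil   : [] ≈ᴹ []
    cons  : ∀ {x y xs ys} → x ≐ y → xs ≈ᴹ ys → (x ∷ xs) ≈ᴹ (y ∷ ys)
    swap  : ∀ {x y xs} → (x ∷ y ∷ xs) ≈ᴹ (y ∷ x ∷ xs)
    trans : ∀ {xs ys zs} → xs ≈ᴹ ys → ys ≈ᴹ zs → xs ≈ᴹ zs

isEmpty : List D → Bool
isEmpty [] = true
isEmpty (_ ∷ _) = false

-- length ℓ(α): index of the last non-empty multiset
len : List (List D) → ℕ
len [] = 0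
len (a ∷ as) with len as
... | suc n = suc (suc n)
... | zero = if isEmpty a then 0 else 1

lams : ℕ → Term → Term
lams zero M = M
lams (suc n) M = lam (lams n M)

apps : Term → List Bag → Term
apps M [] = M
apps M (P ∷ Ps) = apps (app M P) Ps

-- α⁺ (closed term) and α⁻[·] (test-context, given as a function of
-- the term plugged into its hole, which is not under any binder)

mutual
  plus : D → Term
  plus (mk as) = lams (len as) (tst (plusBody (len as) 1 as))

  -- ∥ᵢ (α_{i,1}⁻[xᵢ] ∣ ⋯ ∣ α_{i,kᵢ}⁻[xᵢ]); with r binders, xᵢ has
  -- de Bruijn index r ∸ i
  plusBody : ℕ → ℕ → List (List D) → Test
  plusBody r i [] = []
  plusBody r i (a ∷ as) = minusList r i a ∣ plusBody r (suc i) as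

  minusList : ℕ → ℕ → List D → Test
  minusList r i [] = []
  minusList r i (b ∷ bs) = minus b (var (r ∸ i)) ∣ minusList r i bs

  minus : D → Term → Test
  minus (mk as) M = apps M (bags (len as) as) ∷ []

  bags : ℕ → List (List D) → List Bag
  bags zero as = []
  bags (suc n) [] = []
  bags (suc n) (a ∷ as) = plusList a ∷ bags n as

  plusList : List D → Bag
  plusList [] = []
  plusList (b ∷ bs) = plus b ∷ plusList bs

-- Write α⁻[β⁺] = τ[β⁺ P₁ ⋯ Pᵣ], Pᵢ the bag of the α_{i,j}⁺. Each β-step
-- substitutes the elements of Pᵢ linearly, each into its own hole β_{i,j}⁻[xᵢ]
-- of the body of β⁺, and the following {0/xᵢ} kills every summand in which a
-- hole was left unfilled. Surplus bags are annihilated by τ̄, surplus λs by the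
-- test rule τ[λx.M] → τ[M{0/x}], as the last group of β is non-empty. What
-- remains is a sum, over the ways of matching each βᵢ bijectively with αᵢ, of
-- parallel compositions of tests δ⁻[γ⁺] with δ in β and γ in α. By induction
-- on α and β together, each of these reduces to ε if δ = γ and to 0 otherwise;
-- so a summand reduces to ε exactly when its matching pairs equal elements,
-- which is possible iff α = β, and by idempotence of sums the surviving copies
-- of ε collapse to one.

module Submission where

open import Data.Bool using (Bool; true; false; if_then_else_; _∨_; not; T)
open import Data.Bool.Properties using (∨-assoc; ∨-identityʳ; ∨-zeroʳ; T-≡)
open import Data.Empty using (⊥)
open import Data.List using (List; []; _∷_; _++_; map; concat; concatMap; foldl; length; take; zipWith)
open import Data.List.Properties
  using (++-assoc; ++-identityʳ; map-++; map-∘; map-cong; map-id; length-take;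
         concatMap-cong; concatMap-map; map-concatMap)
open import Data.List.Relation.Unary.All as All using (All; []; _∷_)
import Data.List.Relation.Unary.All.Properties as Allₚ
open import Data.List.Relation.Unary.Any as Any using (Any; here; there)
import Data.List.Relation.Unary.Any.Properties as Anyₚ
open import Data.List.Relation.Binary.Pointwise as Pointwise using (Pointwise; []; _∷_; Pointwise-length)
open import Data.List.Relation.Binary.Permutation.Propositional.Properties
  using (shifts; drop-mid; ↭-empty-inv; ∈-resp-↭) renaming (shift to ↭-shift)
open import Data.List.Membership.Propositional using (_∈_; find; lose)
open import Data.List.Membership.Propositional.Properties
  using (∈-map⁺; ∈-map⁻; ∈-++⁺ˡ; ∈-++⁺ʳ; ∈-∃++; ∈-concatMap⁺; ∈-concatMap⁻)
open import Data.List.Relation.Binary.Permutation.Propositional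
  using (_↭_; ↭-sym; ↭-trans; ↭-reflexive; prep; swap) renaming (refl to ↭-refl′; trans to ↭-trans′)
open import Data.Maybe using (Maybe; just; nothing)
open import Data.Nat using (ℕ; zero; suc; _+_; _∸_; _<ᵇ_; _≡ᵇ_; _≤_; _<_; z≤n; s≤s; pred)
open import Data.Nat.Properties
  using (<⇒<ᵇ; ≡ᵇ⇒≡; <⇒≢; <-≤-trans; ≤-refl; n≤1+n; m≤n⇒m<n∨m≡n; +-identityʳ; +-suc;
         ∸-monoʳ-≤; pred[m∸n]≡m∸[1+n]; m≤n⇒m⊓n≡m)
open import Data.Product using (∃; _×_; _,_; proj₁; proj₂)
open import Data.Sum using (_⊎_; inj₁; inj₂; [_,_])
open import Data.Unit using (⊤; tt)
open import Function using (_∘′_)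
open import Function.Bundles using (Equivalence)
open import Relation.Binary.PropositionalEquality
  using (_≡_; _≢_; refl; sym; cong; cong₂; subst; subst₂; module ≡-Reasoning)
  renaming (trans to ≡-trans)
open import Relation.Binary.Construct.Closure.ReflexiveTransitive using (_◅_; _◅◅_) renaming (ε to ↠-refl)
open import Relation.Nullary using (¬_; contradiction)

open import Defs

data Closed : ℕ → Term → Set where
  var : ∀ {n y} → y < n → Closed n (var y)
  lam : ∀ {n M} → Closed (suc n) M → Closed n (lam M)
  app : ∀ {n M P} → Closed n M → All (Closed n) P → Closed n (app M P)
  tst : ∀ {n V} → All (Closed n) V → Closed n (tst V)

<⇒<ᵇ≡true : ∀ {y n} → y < n → (y <ᵇ n) ≡ true
<⇒<ᵇ≡true y<n = Equivalence.to T-≡ (<⇒<ᵇ y<n)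

≢⇒≡ᵇ≡false : ∀ {y x} → y ≢ x → (y ≡ᵇ x) ≡ false
≢⇒≡ᵇ≡false {y} {x} y≢x with y ≡ᵇ x in eq
... | false = refl
... | true = contradiction (≡ᵇ⇒≡ y x (subst T (sym eq) tt)) y≢x

≡ᵇ-refl : ∀ x → (x ≡ᵇ x) ≡ true
≡ᵇ-refl zero = refl
≡ᵇ-refl (suc x) = ≡ᵇ-refl x

mutual
  weaken : ∀ {m n M} → m ≤ n → Closed m M → Closed n M
  weaken m≤n (var y<m) = var (<-≤-trans y<m m≤n)
  weaken m≤n (lam cl) = lam (weaken (s≤s m≤n) cl)
  weaken m≤n (app cl cls) = app (weaken m≤n cl) (weakenL m≤n cls)
  weaken m≤n (tst cls) = tst (weakenL m≤n cls)

  weakenL : ∀ {m n Ms} → m ≤ n → All (Closed m) Ms → All (Closed n) Ms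
  weakenL m≤n [] = []
  weakenL m≤n (cl ∷ cls) = weaken m≤n cl ∷ weakenL m≤n cls

mutual
  shift-closed : ∀ {c M} → Closed c M → shift c M ≡ M
  shift-closed (var y<c) rewrite <⇒<ᵇ≡true y<c = refl
  shift-closed (lam cl) = cong lam (shift-closed cl)
  shift-closed (app cl cls) = cong₂ app (shift-closed cl) (shiftL-closed cls)
  shift-closed (tst cls) = cong tst (shiftL-closed cls)

  shiftL-closed : ∀ {c Ms} → All (Closed c) Ms → shiftL c Ms ≡ Ms
  shiftL-closed [] = refl
  shiftL-closed (cl ∷ cls) = cong₂ _∷_ (shift-closed cl) (shiftL-closed cls)

mutual
  lower-closed : ∀ {c M} → Closed c M → lower c M ≡ M
  lower-closed (var y<c) rewrite <⇒<ᵇ≡true y<c = refl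
  lower-closed (lam cl) = cong lam (lower-closed cl)
  lower-closed (app cl cls) = cong₂ app (lower-closed cl) (lowerL-closed cls)
  lower-closed (tst cls) = cong tst (lowerL-closed cls)

  lowerL-closed : ∀ {c Ms} → All (Closed c) Ms → lowerL c Ms ≡ Ms
  lowerL-closed [] = refl
  lowerL-closed (cl ∷ cls) = cong₂ _∷_ (lower-closed cl) (lowerL-closed cls)

mutual
  occurs-closed : ∀ {n y M} → Closed n M → n ≤ y → occurs y M ≡ false
  occurs-closed (var x<n) n≤y = ≢⇒≡ᵇ≡false (<⇒≢ (<-≤-trans x<n n≤y))
  occurs-closed (lam cl) n≤y = occurs-closed cl (s≤s n≤y)
  occurs-closed (app cl cls) n≤y rewrite occurs-closed cl n≤y = occursL-closed cls n≤y
  occurs-closed (tst cls) n≤y = occursL-closed cls n≤y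

  occursL-closed : ∀ {n y Ms} → All (Closed n) Ms → n ≤ y → occursL y Ms ≡ false
  occursL-closed [] n≤y = refl
  occursL-closed (cl ∷ cls) n≤y rewrite occurs-closed cl n≤y = occursL-closed cls n≤y

mutual
  lsub-closed : ∀ {x N M} → Closed x M → lsub x N M ≡ []
  lsub-closed (var y<x) rewrite ≢⇒≡ᵇ≡false (<⇒≢ y<x) = refl
  lsub-closed {x} {N} (lam cl) rewrite lsub-closed {suc x} {shift 0 N} cl = refl
  lsub-closed {x} {N} (app cl cls) rewrite lsub-closed {x} {N} cl | lsubL-closed {x} {N} cls = refl
  lsub-closed {x} {N} (tst cls) rewrite lsubL-closed {x} {N} cls = refl

  lsubL-closed : ∀ {x N Ms} → All (Closed x) Ms → lsubL x N Ms ≡ []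
  lsubL-closed [] = refl
  lsubL-closed {x} {N} (cl ∷ cls) rewrite lsub-closed {x} {N} cl | lsubL-closed {x} {N} cls = refl

∨≡false : ∀ a {b} → a ∨ b ≡ false → a ≡ false × b ≡ false
∨≡false false eq = refl , eq

mutual
  strengthen : ∀ {m M} → Closed (suc m) M → occurs m M ≡ false → Closed m M
  strengthen {m} (var {y = y} (s≤s y≤m)) ¬occ with m≤n⇒m<n∨m≡n y≤m
  ... | inj₁ y<m = var y<m
  ... | inj₂ refl = contradiction (≡-trans (sym (≡ᵇ-refl y)) ¬occ) λ ()
  strengthen (lam cl) ¬occ = lam (strengthen cl ¬occ)
  strengthen {m} (app {M = M} cl cls) ¬occ with ∨≡false (occurs m M) ¬occ
  ... | ¬occM , ¬occP = app (strengthen cl ¬occM) (strengthenL cls ¬occP)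
  strengthen (tst cls) ¬occ = tst (strengthenL cls ¬occ)

  strengthenL : ∀ {m Ms} → All (Closed (suc m)) Ms → occursL m Ms ≡ false → All (Closed m) Ms
  strengthenL [] _ = []
  strengthenL {m} (_∷_ {x = M} cl cls) ¬occ with ∨≡false (occurs m M) ¬occ
  ... | ¬occM , ¬occMs = strengthen cl ¬occM ∷ strengthenL cls ¬occMs

data Trimmed : List (List D) → Set where
  []   : Trimmed []
  last : ∀ {d z} → Trimmed ((d ∷ z) ∷ [])
  cons : ∀ {a b bs} → Trimmed (b ∷ bs) → Trimmed (a ∷ b ∷ bs)

-- Sequences are compared through nth, so trailing empty multisets are
-- invisible to ≐; trim removes them.
trim : List (List D) → List (List D)
trim as = take (len as) as

Trimmed-tail : ∀ {a as} → Trimmed (a ∷ as) → Trimmed as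
Trimmed-tail last = []
Trimmed-tail (cons t) = t

trim-Trimmed : ∀ as → Trimmed (trim as)
trim-Trimmed [] = []
trim-Trimmed (a ∷ as) with len as in eq | trim-Trimmed as
trim-Trimmed (a ∷ []) | suc n | _ with () ← eq
trim-Trimmed (a ∷ a′ ∷ as) | suc n | t = cons t
trim-Trimmed ([] ∷ as) | zero | _ = []
trim-Trimmed ((d ∷ z) ∷ as) | zero | _ = last

len≤length : ∀ as → len as ≤ length as
len≤length [] = z≤n
len≤length (a ∷ as) with len as | len≤length as
... | suc n | ℓ≤ = s≤s ℓ≤
len≤length ([] ∷ as) | zero | _ = z≤n
len≤length ((d ∷ z) ∷ as) | zero | _ = s≤s z≤n

length-trim : ∀ as → length (trim as) ≡ len as
length-trim as = ≡-trans (length-take (len as) as) (m≤n⇒m⊓n≡m (len≤length as))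

nth-beyond-len : ∀ as k → len as ≤ k → nth as k ≡ []
nth-beyond-len [] k _ = refl
nth-beyond-len (a ∷ as) k ℓ≤k with len as | nth-beyond-len as
nth-beyond-len (a ∷ as) (suc k) (s≤s ℓ≤k) | suc n | ih = ih k ℓ≤k
nth-beyond-len ([] ∷ as) zero _ | zero | _ = refl
nth-beyond-len ([] ∷ as) (suc k) _ | zero | ih = ih k z≤n
nth-beyond-len ((d ∷ z) ∷ as) (suc k) _ | zero | ih = ih k z≤n

nth-take : ∀ k as → (∀ j → k ≤ j → nth as j ≡ []) → ∀ i → nth (take k as) i ≡ nth as i
nth-take zero as empty i = sym (empty i z≤n)
nth-take (suc k) [] empty i = refl
nth-take (suc k) (a ∷ as) empty zero = refl
nth-take (suc k) (a ∷ as) empty (suc i) = nth-take k as (λ j k≤j → empty (suc j) (s≤s k≤j)) i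

nth-trim : ∀ as i → nth (trim as) i ≡ nth as i
nth-trim as = nth-take (len as) as (nth-beyond-len as)

plusBody-empty : ∀ r i bs → (∀ j → nth bs j ≡ []) → plusBody r i bs ≡ []
plusBody-empty r i [] empty = refl
plusBody-empty r i (b ∷ bs) empty with empty 0
... | refl = plusBody-empty r (suc i) bs (λ j → empty (suc j))

plusBody-take : ∀ r i k bs → (∀ j → k ≤ j → nth bs j ≡ []) →
                plusBody r i (take k bs) ≡ plusBody r i bs
plusBody-take r i zero bs empty = sym (plusBody-empty r i bs (λ j → empty j z≤n))
plusBody-take r i (suc k) [] empty = refl
plusBody-take r i (suc k) (b ∷ bs) empty =
  cong (minusList r i b ++_) (plusBody-take r (suc i) k bs (λ j k≤j → empty (suc j) (s≤s k≤j)))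

plusBody-trim : ∀ r i bs → plusBody r i (trim bs) ≡ plusBody r i bs
plusBody-trim r i bs = plusBody-take r i (len bs) bs (nth-beyond-len bs)

bags-take : ∀ k as → bags k as ≡ map plusList (take k as)
bags-take zero as = refl
bags-take (suc k) [] = refl
bags-take (suc k) (a ∷ as) = cong (plusList a ∷_) (bags-take k as)

mutual
  ≐-refl : ∀ α → α ≐ α
  ≐-refl (mk as) = mk (nth-≈ᴹ-refl as)

  nth-≈ᴹ-refl : ∀ as i → nth as i ≈ᴹ nth as i
  nth-≈ᴹ-refl [] i = nil
  nth-≈ᴹ-refl (a ∷ as) zero = ≈ᴹ-refl a
  nth-≈ᴹ-refl (a ∷ as) (suc i) = nth-≈ᴹ-refl as i

  ≈ᴹ-refl : ∀ xs → xs ≈ᴹ xs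
  ≈ᴹ-refl [] = nil
  ≈ᴹ-refl (x ∷ xs) = cons (≐-refl x) (≈ᴹ-refl xs)

mutual
  ≐-sym : ∀ {α β} → α ≐ β → β ≐ α
  ≐-sym (mk f) = mk (λ i → ≈ᴹ-sym (f i))

  ≈ᴹ-sym : ∀ {xs ys} → xs ≈ᴹ ys → ys ≈ᴹ xs
  ≈ᴹ-sym nil = nil
  ≈ᴹ-sym (cons p q) = cons (≐-sym p) (≈ᴹ-sym q)
  ≈ᴹ-sym swap = swap
  ≈ᴹ-sym (trans p q) = trans (≈ᴹ-sym q) (≈ᴹ-sym p)

≐-trans : ∀ {α β γ} → α ≐ β → β ≐ γ → α ≐ γ
≐-trans (mk f) (mk g) = mk (λ i → trans (f i) (g i))

≈ᴹ-length : ∀ {xs ys} → xs ≈ᴹ ys → length xs ≡ length ys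
≈ᴹ-length nil = refl
≈ᴹ-length (cons _ q) = cong suc (≈ᴹ-length q)
≈ᴹ-length swap = refl
≈ᴹ-length (trans p q) = ≡-trans (≈ᴹ-length p) (≈ᴹ-length q)

↭⇒≈ᴹ : ∀ {xs ys} → xs ↭ ys → xs ≈ᴹ ys
↭⇒≈ᴹ {xs} ↭-refl′ = ≈ᴹ-refl xs
↭⇒≈ᴹ (prep x p) = cons (≐-refl x) (↭⇒≈ᴹ p)
↭⇒≈ᴹ (swap x y p) = trans swap (cons (≐-refl y) (cons (≐-refl x) (↭⇒≈ᴹ p)))
↭⇒≈ᴹ (↭-trans′ p q) = trans (↭⇒≈ᴹ p) (↭⇒≈ᴹ q)

Pointwise⇒≈ᴹ : ∀ {xs ys} → Pointwise _≐_ xs ys → xs ≈ᴹ ys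
Pointwise⇒≈ᴹ [] = nil
Pointwise⇒≈ᴹ (p ∷ ps) = cons p (Pointwise⇒≈ᴹ ps)

↭-Pointwise-commute : ∀ {us ys vs} → us ↭ ys → Pointwise _≐_ ys vs →
                      ∃ λ ws → Pointwise _≐_ us ws × ws ↭ vs
↭-Pointwise-commute {vs = vs} ↭-refl′ pw = vs , pw , ↭-refl′
↭-Pointwise-commute (prep x p) (e ∷ pw) with ↭-Pointwise-commute p pw
... | ws , pw′ , p′ = _ , e ∷ pw′ , prep _ p′
↭-Pointwise-commute (swap x y p) (e₁ ∷ e₂ ∷ pw) with ↭-Pointwise-commute p pw
... | ws , pw′ , p′ = _ , e₂ ∷ e₁ ∷ pw′ , swap _ _ p′
↭-Pointwise-commute (↭-trans′ p₁ p₂) pw with ↭-Pointwise-commute p₂ pw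
... | ws₁ , pw₁ , p₂′ with ↭-Pointwise-commute p₁ pw₁
... | ws , pw′ , p₁′ = ws , pw′ , ↭-trans p₁′ p₂′

≈ᴹ⇒Pointwise-↭ : ∀ {xs ys} → xs ≈ᴹ ys → ∃ λ zs → ys ↭ zs × Pointwise _≐_ xs zs
≈ᴹ⇒Pointwise-↭ nil = [] , ↭-refl′ , []
≈ᴹ⇒Pointwise-↭ (cons {y = y} e q) with ≈ᴹ⇒Pointwise-↭ q
... | zs , p , pw = y ∷ zs , prep y p , e ∷ pw
≈ᴹ⇒Pointwise-↭ (swap {x} {y} {xs}) =
  x ∷ y ∷ xs , swap y x ↭-refl′ , Pointwise.refl (≐-refl _)
≈ᴹ⇒Pointwise-↭ (trans p q) with ≈ᴹ⇒Pointwise-↭ p | ≈ᴹ⇒Pointwise-↭ q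
... | us , p₁ , pw₁ | vs , p₂ , pw₂ with ↭-Pointwise-commute (↭-sym p₁) pw₂
... | ws , pw₃ , p₃ = ws , ↭-trans p₂ (↭-sym p₃) , Pointwise.transitive ≐-trans pw₁ pw₃

nonempty-somewhere : ∀ {a as} → Trimmed (a ∷ as) → ¬ (∀ i → length (nth (a ∷ as) i) ≡ 0)
nonempty-somewhere last empty = contradiction (empty 0) λ ()
nonempty-somewhere (cons t) empty = nonempty-somewhere t (λ i → empty (suc i))

nth-≈ᴹ⇒Pointwise : ∀ {as bs} → Trimmed as → Trimmed bs →
                   (∀ i → nth as i ≈ᴹ nth bs i) → Pointwise _≈ᴹ_ as bs
nth-≈ᴹ⇒Pointwise {[]} {[]} _ _ f = []
nth-≈ᴹ⇒Pointwise {[]} {_ ∷ _} _ tb f =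
  contradiction (λ i → sym (≈ᴹ-length (f i))) (nonempty-somewhere tb)
nth-≈ᴹ⇒Pointwise {_ ∷ _} {[]} ta _ f =
  contradiction (λ i → ≈ᴹ-length (f i)) (nonempty-somewhere ta)
nth-≈ᴹ⇒Pointwise {_ ∷ _} {_ ∷ _} ta tb f =
  f 0 ∷ nth-≈ᴹ⇒Pointwise (Trimmed-tail ta) (Trimmed-tail tb) (λ i → f (suc i))

Pointwise⇒nth-≈ᴹ : ∀ {as bs} → Pointwise _≈ᴹ_ as bs → ∀ i → nth as i ≈ᴹ nth bs i
Pointwise⇒nth-≈ᴹ [] i = nil
Pointwise⇒nth-≈ᴹ (p ∷ ps) zero = p
Pointwise⇒nth-≈ᴹ (p ∷ ps) (suc i) = Pointwise⇒nth-≈ᴹ ps i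

≐⇒Pointwise-trim : ∀ {as bs} → mk as ≐ mk bs → Pointwise _≈ᴹ_ (trim as) (trim bs)
≐⇒Pointwise-trim {as} {bs} (mk f) =
  nth-≈ᴹ⇒Pointwise (trim-Trimmed as) (trim-Trimmed bs)
    (λ i → subst₂ _≈ᴹ_ (sym (nth-trim as i)) (sym (nth-trim bs i)) (f i))

Pointwise-trim⇒≐ : ∀ {as bs} → Pointwise _≈ᴹ_ (trim as) (trim bs) → mk as ≐ mk bs
Pointwise-trim⇒≐ {as} {bs} pw =
  mk (λ i → subst₂ _≈ᴹ_ (nth-trim as i) (nth-trim bs i) (Pointwise⇒nth-≈ᴹ pw i))

contextBags : D → List Bag
contextBags (mk as) = bags (len as) as

minus≡apps : ∀ β H → minus β H ≡ apps H (contextBags β) ∷ []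
minus≡apps (mk as) H = refl

apps-closed : ∀ {n H} Bs → Closed n H → All (All (Closed n)) Bs → Closed n (apps H Bs)
apps-closed [] cl [] = cl
apps-closed (B ∷ Bs) cl (clB ∷ clBs) = apps-closed Bs (app cl clB) clBs

lams-closed : ∀ k {n M} → Closed (k + n) M → Closed n (lams k M)
lams-closed zero cl = cl
lams-closed (suc k) {n} {M} cl = lam (lams-closed k (subst (λ m → Closed m M) (sym (+-suc k n)) cl))

lams-closed₀ : ∀ k {M} → Closed k M → Closed 0 (lams k M)
lams-closed₀ k {M} cl = lams-closed k (subst (λ m → Closed m M) (sym (+-identityʳ k)) cl)

mutual
  plus-closed : ∀ β → Closed 0 (plus β)
  plus-closed (mk bs) with len bs in eq
  ... | zero = tst (subst (All (Closed 0)) (sym (plusBody-empty 0 1 bs empty)) [])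
    where empty : ∀ j → nth bs j ≡ []
          empty j = nth-beyond-len bs j (subst (_≤ j) (sym eq) z≤n)
  ... | suc r = lams-closed₀ (suc r) (tst (plusBody-closed (suc r) 1 bs))

  plusList-closed : ∀ a {n} → All (Closed n) (plusList a)
  plusList-closed [] = []
  plusList-closed (b ∷ a) = weaken z≤n (plus-closed b) ∷ plusList-closed a

  bags-closed : ∀ k as {n} → All (All (Closed n)) (bags k as)
  bags-closed zero as = []
  bags-closed (suc k) [] = []
  bags-closed (suc k) (a ∷ as) = plusList-closed a ∷ bags-closed k as

  minus-closed : ∀ β {n H} → Closed n H → All (Closed n) (minus β H)
  minus-closed (mk bs) cl = apps-closed (bags (len bs) bs) cl (bags-closed (len bs) bs) ∷ []

  minusList-closed : ∀ r i a → All (Closed (suc (r ∸ i))) (minusList r i a)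
  minusList-closed r i [] = []
  minusList-closed r i (b ∷ a) = Allₚ.++⁺ (minus-closed b (var ≤-refl)) (minusList-closed r i a)

  plusBody-closed : ∀ r i as → All (Closed (suc (r ∸ i))) (plusBody r i as)
  plusBody-closed r i [] = []
  plusBody-closed r i (a ∷ as) =
    Allₚ.++⁺ (minusList-closed r i a)
             (weakenL (s≤s (∸-monoʳ-≤ r (n≤1+n i))) (plusBody-closed r (suc i) as))

contextBags-closed : ∀ β {n} → All (All (Closed n)) (contextBags β)
contextBags-closed (mk bs) = bags-closed (len bs) bs

Step : List Test → List Test → Set
Step S T = (S ⟶ₛ T) ⊎ (S ≈ₛ T)

τ⟨_⟩ : Term → List Test
τ⟨ M ⟩ = (M ∷ []) ∷ []

Succeeds Vanishes : Test → Set
Succeeds V = (V ∷ []) ↠ (ε ∷ [])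
Vanishes V = (V ∷ []) ↠ []

mutual
  ≃-refl : ∀ M → M ≃ M
  ≃-refl (var x) = var
  ≃-refl (lam M) = lam (≃-refl M)
  ≃-refl (app M P) = app (≃-refl M) (≃ᴸ-refl P)
  ≃-refl (tst V) = tst (≃ᴸ-refl V)

  ≃ᴸ-refl : ∀ xs → xs ≃ᴸ xs
  ≃ᴸ-refl [] = nil
  ≃ᴸ-refl (x ∷ xs) = cons (≃-refl x) (≃ᴸ-refl xs)

≃ᴸ-++ˡ : ∀ {xs xs′} ys → xs ≃ᴸ xs′ → (xs ++ ys) ≃ᴸ (xs′ ++ ys)
≃ᴸ-++ˡ ys nil = ≃ᴸ-refl ys
≃ᴸ-++ˡ ys (cons x p) = cons x (≃ᴸ-++ˡ ys p)
≃ᴸ-++ˡ ys swap = swap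
≃ᴸ-++ˡ ys (trans p p′) = trans (≃ᴸ-++ˡ ys p) (≃ᴸ-++ˡ ys p′)

≃ᴸ-++ʳ : ∀ xs {ys ys′} → ys ≃ᴸ ys′ → (xs ++ ys) ≃ᴸ (xs ++ ys′)
≃ᴸ-++ʳ [] q = q
≃ᴸ-++ʳ (x ∷ xs) q = cons (≃-refl x) (≃ᴸ-++ʳ xs q)

↭⇒≃ᴸ : ∀ {xs ys} → xs ↭ ys → xs ≃ᴸ ys
↭⇒≃ᴸ {xs} ↭-refl′ = ≃ᴸ-refl xs
↭⇒≃ᴸ (prep x p) = cons (≃-refl x) (↭⇒≃ᴸ p)
↭⇒≃ᴸ (swap x y p) = trans swap (cons (≃-refl y) (cons (≃-refl x) (↭⇒≃ᴸ p)))
↭⇒≃ᴸ (↭-trans′ p q) = trans (↭⇒≃ᴸ p) (↭⇒≃ᴸ q)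

_⊆ₛ_ : List Test → List Test → Set
S ⊆ₛ T = All (λ V → Any (V ≃ᴸ_) T) S

⊆ₛ-refl : ∀ S → S ⊆ₛ S
⊆ₛ-refl [] = []
⊆ₛ-refl (V ∷ S) = here (≃ᴸ-refl V) ∷ All.map there (⊆ₛ-refl S)

≡⇒≈ₛ : ∀ {S T} → S ≡ T → S ≈ₛ T
≡⇒≈ₛ {S} refl = ⊆ₛ-refl S , ⊆ₛ-refl S

⊆ₛ-wrap : ∀ xs {S T} ys → S ⊆ₛ T → (xs ++ S ++ ys) ⊆ₛ (xs ++ T ++ ys)
⊆ₛ-wrap xs {T = T} ys S⊆T =
  Allₚ.++⁺ (All.map Anyₚ.++⁺ˡ (⊆ₛ-refl xs))
    (Allₚ.++⁺ (All.map (Anyₚ.++⁺ʳ xs ∘′ Anyₚ.++⁺ˡ) S⊆T)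
              (All.map (Anyₚ.++⁺ʳ xs ∘′ Anyₚ.++⁺ʳ T) (⊆ₛ-refl ys)))

⊆ₛ-map : ∀ (f : Test → Test) → (∀ {V W} → V ≃ᴸ W → f V ≃ᴸ f W) →
         ∀ {S T} → S ⊆ₛ T → map f S ⊆ₛ map f T
⊆ₛ-map f f-resp [] = []
⊆ₛ-map f f-resp (V∈T ∷ S⊆T) = Anyₚ.map⁺ (Any.map f-resp V∈T) ∷ ⊆ₛ-map f f-resp S⊆T

regroup : ∀ {A : Set} (xs as cs ys : List A) → (xs ++ as) ++ cs ++ ys ≡ xs ++ (as ++ cs) ++ ys
regroup xs as cs ys = ≡-trans (++-assoc xs as (cs ++ ys)) (cong (xs ++_) (sym (++-assoc as cs ys)))

Step-wrap : ∀ xs ys {S T} → Step S T → Step (xs ++ S ++ ys) (xs ++ T ++ ys)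
Step-wrap xs ys (inj₁ (step {V} {T} as bs r)) =
  inj₁ (subst₂ _⟶ₛ_ (regroup xs as (V ∷ bs) ys) target (step (xs ++ as) (bs ++ ys) r))
  where
    target : (xs ++ as) ++ T ++ bs ++ ys ≡ xs ++ (as ++ T ++ bs) ++ ys
    target = ≡-trans (cong ((xs ++ as) ++_) (sym (++-assoc T bs ys))) (regroup xs as (T ++ bs) ys)
Step-wrap xs ys (inj₂ (S⊆T , T⊆S)) = inj₂ (⊆ₛ-wrap xs ys S⊆T , ⊆ₛ-wrap xs ys T⊆S)

↠-wrap : ∀ xs ys {S T} → S ↠ T → (xs ++ S ++ ys) ↠ (xs ++ T ++ ys)
↠-wrap xs ys ↠-refl = ↠-refl
↠-wrap xs ys (s ◅ r) = Step-wrap xs ys s ◅ ↠-wrap xs ys r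

↠-++ʳ : ∀ ys {S T} → S ↠ T → (S ++ ys) ↠ (T ++ ys)
↠-++ʳ = ↠-wrap []

↠-++ˡ : ∀ xs {S T} → S ↠ T → (xs ++ S) ↠ (xs ++ T)
↠-++ˡ xs {S} {T} r =
  subst₂ _↠_ (cong (xs ++_) (++-identityʳ S)) (cong (xs ++_) (++-identityʳ T)) (↠-wrap xs [] r)

↠-concatMap : ∀ {X : Set} (f g : X → List Test) → (∀ x → f x ↠ g x) →
              ∀ xs → concatMap f xs ↠ concatMap g xs
↠-concatMap f g f↠g [] = ↠-refl
↠-concatMap f g f↠g (x ∷ xs) =
  ↠-++ʳ (concatMap f xs) (f↠g x) ◅◅ ↠-++ˡ (g x) (↠-concatMap f g f↠g xs)

↠-step : ∀ {V T} → V ⟶ᵗ T → (V ∷ []) ↠ T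
↠-step {T = T} r = subst (_ ↠_) (++-identityʳ T) (inj₁ (step [] [] r) ◅ ↠-refl)

↠-term : ∀ {M S} → M ⟶ S → τ⟨ M ⟩ ↠ map (_∷ []) S
↠-term r = ↠-step (c-el [] [] r)

⟶-apps : ∀ {M S} Ps → M ⟶ S → apps M Ps ⟶ map (λ M′ → apps M′ Ps) S
⟶-apps {S = S} [] r = subst (_ ⟶_) (sym (map-id S)) r
⟶-apps {S = S} (P ∷ Ps) r = subst (_ ⟶_) (sym (map-∘ S)) (⟶-apps Ps (c-appL r))

inContext : List Term → List Term → Test → Test
inContext xs ys V = xs ++ V ++ ys

inContext-resp : ∀ xs ys {V W} → V ≃ᴸ W → inContext xs ys V ≃ᴸ inContext xs ys W
inContext-resp xs ys p = ≃ᴸ-++ʳ xs (≃ᴸ-++ˡ ys p)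

regroup-around : ∀ (xs as : List Term) L (bs ys : List Term) →
                 xs ++ (as ++ L ∷ bs) ++ ys ≡ (xs ++ as) ++ L ∷ (bs ++ ys)
regroup-around xs as L bs ys =
  ≡-trans (cong (xs ++_) (++-assoc as (L ∷ bs) ys)) (sym (++-assoc xs as (L ∷ bs ++ ys)))

map-regroup-around : ∀ xs as bs ys (S : List Term) →
  map (λ L → (xs ++ as) ++ L ∷ (bs ++ ys)) S ≡ map (inContext xs ys) (map (λ L → as ++ L ∷ bs) S)
map-regroup-around xs as bs ys S = ≡-trans (map-cong (λ L → sym (regroup-around xs as L bs ys)) S) (map-∘ S)

cast⟶ᵗ : ∀ {V W T} → V ≡ W → W ⟶ᵗ T → V ⟶ᵗ T
cast⟶ᵗ refl r = r

⟶ᵗ-inContext : ∀ xs ys {V T} → V ⟶ᵗ T →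
               ∃ λ T′ → (inContext xs ys V ⟶ᵗ T′) × (T′ ≈ₛ map (inContext xs ys) T)
⟶ᵗ-inContext xs ys (τλ {M} as bs) =
  map (λ L → (xs ++ as) ++ L ∷ (bs ++ ys)) (erase 0 M) ,
  cast⟶ᵗ (regroup-around xs as (lam M) bs ys) (τλ (xs ++ as) (bs ++ ys)) ,
  ≡⇒≈ₛ (map-regroup-around xs as bs ys (erase 0 M))
⟶ᵗ-inContext xs ys (c-el {L} {S} as bs r) =
  map (λ L → (xs ++ as) ++ L ∷ (bs ++ ys)) S ,
  cast⟶ᵗ (regroup-around xs as L bs ys) (c-el (xs ++ as) (bs ++ ys) r) ,
  ≡⇒≈ₛ (map-regroup-around xs as bs ys S)
⟶ᵗ-inContext xs ys (ττ̄ {V} as bs) =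
  (V ∣ ((xs ++ as) ++ (bs ++ ys))) ∷ [] ,
  cast⟶ᵗ (regroup-around xs as (tst V) bs ys) (ττ̄ (xs ++ as) (bs ++ ys)) ,
  (here (↭⇒≃ᴸ (↭-sym perm)) ∷ []) , (here (↭⇒≃ᴸ perm) ∷ [])
  where
    perm : inContext xs ys (V ∣ (as ++ bs)) ↭ V ∣ ((xs ++ as) ++ (bs ++ ys))
    perm = ↭-trans (↭-reflexive (cong (xs ++_) (++-assoc V (as ++ bs) ys)))
             (↭-trans (shifts xs V)
               (↭-reflexive (cong (V ++_) (≡-trans (cong (xs ++_) (++-assoc as bs ys))
                                                   (sym (++-assoc xs as (bs ++ ys)))))))

Step-inContext : ∀ xs ys {S T} → Step S T → map (inContext xs ys) S ↠ map (inContext xs ys) T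
Step-inContext xs ys (inj₁ (step {V} {T} as bs r)) with ⟶ᵗ-inContext xs ys r
... | T′ , r′ , (T′⊆ , ⊆T′) =
  subst₂ _↠_ (sym (map-++ f as (V ∷ bs))) target
    (inj₁ (step (map f as) (map f bs) r′) ◅
     inj₂ (⊆ₛ-wrap (map f as) (map f bs) T′⊆ , ⊆ₛ-wrap (map f as) (map f bs) ⊆T′) ◅ ↠-refl)
  where
    f : Test → Test
    f = inContext xs ys
    target : map f as ++ map f T ++ map f bs ≡ map f (as ++ T ++ bs)
    target = ≡-trans (cong (map f as ++_) (sym (map-++ f T bs))) (sym (map-++ f as (T ++ bs)))
Step-inContext xs ys (inj₂ (S⊆T , T⊆S)) =
  inj₂ (⊆ₛ-map (inContext xs ys) (inContext-resp xs ys) S⊆T ,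
        ⊆ₛ-map (inContext xs ys) (inContext-resp xs ys) T⊆S) ◅ ↠-refl

↠-inContext : ∀ xs ys {S T} → S ↠ T → map (inContext xs ys) S ↠ map (inContext xs ys) T
↠-inContext xs ys ↠-refl = ↠-refl
↠-inContext xs ys (s ◅ r) = Step-inContext xs ys s ◅◅ ↠-inContext xs ys r

Succeeds-inContext : ∀ xs ys {V} → Succeeds V → ((xs ++ V ++ ys) ∷ []) ↠ ((xs ++ ys) ∷ [])
Succeeds-inContext xs ys = ↠-inContext xs ys

Vanishes-inContext : ∀ xs ys {V} → Vanishes V → Vanishes (xs ++ V ++ ys)
Vanishes-inContext xs ys = ↠-inContext xs ys

concat-succeeds : ∀ {Vs} → All Succeeds Vs → Succeeds (concat Vs)
concat-succeeds [] = ↠-refl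
concat-succeeds {V ∷ Vs} (r ∷ rs) = Succeeds-inContext [] (concat Vs) r ◅◅ concat-succeeds rs

concat-vanishes : ∀ {Vs} → Any Vanishes Vs → Vanishes (concat Vs)
concat-vanishes {V ∷ Vs} (here r) = Vanishes-inContext [] (concat Vs) r
concat-vanishes {V ∷ Vs} (there q) =
  subst Vanishes (cong (V ++_) (++-identityʳ (concat Vs))) (Vanishes-inContext V [] (concat-vanishes q))

SucceedsOrVanishes : Test → Set
SucceedsOrVanishes V = Succeeds V ⊎ Vanishes V

all-vanish : ∀ {S} → All Vanishes S → S ↠ []
all-vanish [] = ↠-refl
all-vanish {V ∷ S} (r ∷ rs) = ↠-++ʳ S r ◅◅ all-vanish rs

dup-≈ₛ : ∀ V S → (V ∷ V ∷ S) ≈ₛ (V ∷ S)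
dup-≈ₛ V S = (here V≃V ∷ here V≃V ∷ All.map there (⊆ₛ-refl S)) ,
             (here V≃V ∷ All.map (there ∘′ there) (⊆ₛ-refl S))
  where
    V≃V : V ≃ᴸ V
    V≃V = ≃ᴸ-refl V

ε-absorbs : ∀ {S} → All SucceedsOrVanishes S → (ε ∷ S) ↠ (ε ∷ [])
ε-absorbs [] = ↠-refl
ε-absorbs {V ∷ S} (inj₁ r ∷ rs) = ↠-wrap (ε ∷ []) S r ◅◅ inj₂ (dup-≈ₛ ε S) ◅ ε-absorbs rs
ε-absorbs {V ∷ S} (inj₂ r ∷ rs) = ↠-wrap (ε ∷ []) S r ◅◅ ε-absorbs rs

one-succeeds : ∀ {S} → All SucceedsOrVanishes S → Any Succeeds S → S ↠ (ε ∷ [])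
one-succeeds {V ∷ S} (_ ∷ rs) (here r) = ↠-++ʳ S r ◅◅ ε-absorbs rs
one-succeeds {V ∷ S} (inj₁ r ∷ rs) (there _) = ↠-++ʳ S r ◅◅ ε-absorbs rs
one-succeeds {V ∷ S} (inj₂ r ∷ rs) (there q) = ↠-++ʳ S r ◅◅ one-succeeds rs q

map-map : ∀ {A B B′ C : Set} {f : B → C} {g : A → B} {h : B′ → C} {k : A → B′} xs →
          (∀ x → f (g x) ≡ h (k x)) → map f (map g xs) ≡ map h (map k xs)
map-map xs eq = ≡-trans (sym (map-∘ xs)) (≡-trans (map-cong eq xs) (map-∘ xs))

lsubL-++ : ∀ x N xs ys → lsubL x N (xs ++ ys) ≡ map (_++ ys) (lsubL x N xs) ++ map (xs ++_) (lsubL x N ys)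
lsubL-++ x N [] ys = sym (map-id (lsubL x N ys))
lsubL-++ x N (L ∷ xs) ys = begin
  map (λ L′ → L′ ∷ xs ++ ys) Ls ++ map (L ∷_) (lsubL x N (xs ++ ys))
    ≡⟨ cong (λ Z → map (λ L′ → L′ ∷ xs ++ ys) Ls ++ map (L ∷_) Z) (lsubL-++ x N xs ys) ⟩
  map (λ L′ → L′ ∷ xs ++ ys) Ls ++ map (L ∷_) (map (_++ ys) Xs ++ map (xs ++_) Ys)
    ≡⟨ cong (map (λ L′ → L′ ∷ xs ++ ys) Ls ++_) (map-++ (L ∷_) (map (_++ ys) Xs) (map (xs ++_) Ys)) ⟩
  map (λ L′ → L′ ∷ xs ++ ys) Ls ++ map (L ∷_) (map (_++ ys) Xs) ++ map (L ∷_) (map (xs ++_) Ys)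
    ≡⟨ sym (++-assoc (map (λ L′ → L′ ∷ xs ++ ys) Ls) _ _) ⟩
  (map (λ L′ → L′ ∷ xs ++ ys) Ls ++ map (L ∷_) (map (_++ ys) Xs)) ++ map (L ∷_) (map (xs ++_) Ys)
    ≡⟨ cong₂ _++_ (cong₂ _++_ (map-∘ Ls) (map-map Xs (λ _ → refl))) (sym (map-∘ Ys)) ⟩
  (map (_++ ys) (map (λ L′ → L′ ∷ xs) Ls) ++ map (_++ ys) (map (L ∷_) Xs)) ++ map ((L ∷ xs) ++_) Ys
    ≡⟨ cong (_++ map ((L ∷ xs) ++_) Ys) (map-++ (_++ ys) (map (λ L′ → L′ ∷ xs) Ls) (map (L ∷_) Xs)) ⟨
  map (_++ ys) (map (λ L′ → L′ ∷ xs) Ls ++ map (L ∷_) Xs) ++ map ((L ∷ xs) ++_) Ys ∎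
  where
    open ≡-Reasoning
    Ls : List Term
    Ls = lsub x N L
    Xs Ys : List (List Term)
    Xs = lsubL x N xs
    Ys = lsubL x N ys

lsubL-closed-++ : ∀ {x N F} Y → All (Closed x) F → lsubL x N (F ++ Y) ≡ map (F ++_) (lsubL x N Y)
lsubL-closed-++ {x} {N} {F} Y clF rewrite lsubL-++ x N F Y | lsubL-closed {x} {N} clF = refl

lsubL-++-closed : ∀ {x N R} X → All (Closed x) R → lsubL x N (X ++ R) ≡ map (_++ R) (lsubL x N X)
lsubL-++-closed {x} {N} {R} X clR rewrite lsubL-++ x N X R | lsubL-closed {x} {N} clR =
  ++-identityʳ (map (_++ R) (lsubL x N X))

lsub-apps : ∀ {x N H} Bs → All (All (Closed x)) Bs →
            lsub x N (apps H Bs) ≡ map (λ H′ → apps H′ Bs) (lsub x N H)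
lsub-apps {x} {N} {H} [] _ = sym (map-id (lsub x N H))
lsub-apps {x} {N} {H} (B ∷ Bs) (clB ∷ clBs)
  rewrite lsub-apps {x} {N} {app H B} Bs clBs | lsubL-closed {x} {N} clB
        | ++-identityʳ (map (λ M′ → app M′ B) (lsub x N H)) = sym (map-∘ (lsub x N H))

occurs-apps : ∀ {x H} Bs → All (All (Closed x)) Bs → occurs x (apps H Bs) ≡ occurs x H
occurs-apps [] _ = refl
occurs-apps {x} {H} (B ∷ Bs) (clB ∷ clBs)
  rewrite occurs-apps {x} {app H B} Bs clBs | occursL-closed clB (≤-refl {x}) = ∨-identityʳ (occurs x H)

lsub-lams : ∀ k {x N M} → Closed 0 N → lsub x N (lams k M) ≡ map (lams k) (lsub (k + x) N M)
lsub-lams zero {x} {N} {M} _ = sym (map-id (lsub x N M))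
lsub-lams (suc k) {x} {N} {M} clN
  rewrite shift-closed (weaken {0} {0} z≤n clN) | lsub-lams k {suc x} {N} {M} clN | +-suc k x =
  sym (map-∘ (lsub (suc (k + x)) N M))

occurs-lams : ∀ k {x M} → occurs x (lams k M) ≡ occurs (k + x) M
occurs-lams zero = refl
occurs-lams (suc k) {x} {M} rewrite occurs-lams k {suc x} {M} | +-suc k x = refl

occursL-++ : ∀ x xs ys → occursL x (xs ++ ys) ≡ (occursL x xs ∨ occursL x ys)
occursL-++ x [] ys = refl
occursL-++ x (L ∷ xs) ys rewrite occursL-++ x xs ys = sym (∨-assoc (occurs x L) (occursL x xs) (occursL x ys))

-- A slot (δ , nothing) stands for δ⁻[x], x being the variable substituted for,
-- and (δ , just γ) for δ⁻[γ⁺].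
Slot : Set
Slot = D × Maybe D

slotHead : ℕ → Maybe D → Term
slotHead x nothing = var x
slotHead x (just γ) = plus γ

renderSlot : ℕ → Slot → Test
renderSlot x (δ , h) = minus δ (slotHead x h)

renderS : ℕ → List Slot → Test
renderS x = concatMap (renderSlot x)

holes : List D → List Slot
holes = map (_, nothing)

fillOne : D → List Slot → List (List Slot)
fillOne γ [] = []
fillOne γ ((δ , nothing) ∷ ss) = ((δ , just γ) ∷ ss) ∷ map ((δ , nothing) ∷_) (fillOne γ ss)
fillOne γ ((δ , just γ′) ∷ ss) = map ((δ , just γ′) ∷_) (fillOne γ ss)

fillAll : List D → List (List Slot) → List (List Slot)
fillAll [] Ss = Ss
fillAll (γ ∷ a) Ss = fillAll a (concatMap (fillOne γ) Ss)

full : List Slot → Bool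
full [] = true
full ((δ , nothing) ∷ ss) = false
full ((δ , just _) ∷ ss) = full ss

minusList≡renderS-holes : ∀ r i b → minusList r i b ≡ renderS (r ∸ i) (holes b)
minusList≡renderS-holes r i [] = refl
minusList≡renderS-holes r i (δ ∷ b) = cong (minus δ (var (r ∸ i)) ++_) (minusList≡renderS-holes r i b)

lsubL-minus-hole : ∀ x N δ → lsubL x N (minus δ (var x)) ≡ minus δ N ∷ []
lsubL-minus-hole x N δ
  rewrite minus≡apps δ (var x) | minus≡apps δ N
        | lsub-apps {x} {N} {var x} (contextBags δ) (contextBags-closed δ) | ≡ᵇ-refl x = refl

occursL-minus-hole : ∀ x δ → occursL x (minus δ (var x)) ≡ true
occursL-minus-hole x δ
  rewrite minus≡apps δ (var x) | occurs-apps {x} {var x} (contextBags δ) (contextBags-closed δ)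
        | ≡ᵇ-refl x = refl

minus-plus-closed : ∀ δ γ {x} → All (Closed x) (minus δ (plus γ))
minus-plus-closed δ γ = minus-closed δ (weaken z≤n (plus-closed γ))

renderS-cons : ∀ x s Ss → map (renderSlot x s ++_) (map (renderS x) Ss) ≡ map (renderS x) (map (s ∷_) Ss)
renderS-cons x s Ss = map-map Ss (λ _ → refl)

lsubL-renderS : ∀ x γ ss → lsubL x (plus γ) (renderS x ss) ≡ map (renderS x) (fillOne γ ss)
lsubL-renderS x γ [] = refl
lsubL-renderS x γ ((δ , nothing) ∷ ss)
  rewrite lsubL-++ x (plus γ) (minus δ (var x)) (renderS x ss) | lsubL-minus-hole x (plus γ) δ
        | lsubL-renderS x γ ss =
  cong (renderS x ((δ , just γ) ∷ ss) ∷_) (renderS-cons x (δ , nothing) (fillOne γ ss))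
lsubL-renderS x γ ((δ , just γ′) ∷ ss)
  rewrite lsubL-++ x (plus γ) (minus δ (plus γ′)) (renderS x ss)
        | lsubL-closed {x} {plus γ} (minus-plus-closed δ γ′ {x})
        | lsubL-renderS x γ ss = renderS-cons x (δ , just γ′) (fillOne γ ss)

occursL-renderS : ∀ x ss → occursL x (renderS x ss) ≡ not (full ss)
occursL-renderS x [] = refl
occursL-renderS x ((δ , nothing) ∷ ss)
  rewrite occursL-++ x (minus δ (var x)) (renderS x ss) | occursL-minus-hole x δ = refl
occursL-renderS x ((δ , just γ) ∷ ss)
  rewrite occursL-++ x (minus δ (plus γ)) (renderS x ss)
        | occursL-closed (minus-plus-closed δ γ {x}) (≤-refl {x}) = occursL-renderS x ss

renderS-closed : ∀ {n} x ss → full ss ≡ true → All (Closed n) (renderS x ss)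
renderS-closed x [] _ = []
renderS-closed x ((δ , just γ) ∷ ss) full-ss =
  Allₚ.++⁺ (minus-plus-closed δ γ) (renderS-closed x ss full-ss)

renderS-full : ∀ x ss → full ss ≡ true → renderS x ss ≡ renderS 0 ss
renderS-full x [] _ = refl
renderS-full x ((δ , just γ) ∷ ss) full-ss = cong (minus δ (plus γ) ++_) (renderS-full x ss full-ss)

map-if : ∀ {A B : Set} (h : A → B) b (x : A) →
         map h (if b then x ∷ [] else []) ≡ (if b then h x ∷ [] else [])
map-if h true x = refl
map-if h false x = refl

-- β⁺ under its next λ, partly instantiated: m binders still to come, the
-- earlier groups already rendered as F, the slots ss of the current group, whose
-- variable has index m, and the later groups R.
frame : ℕ → Test → Test → List Slot → Term
frame m F R ss = lams m (tst (F ++ renderS m ss ++ R))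

module _ {m F R} (clF : All (Closed m) F) (clR : All (Closed m) R) where

  lsub-frame : ∀ γ ss → lsub 0 (plus γ) (frame m F R ss) ≡ map (frame m F R) (fillOne γ ss)
  lsub-frame γ ss = begin
    lsub 0 N (lams m (tst W))
      ≡⟨ lsub-lams m (plus-closed γ) ⟩
    map (lams m) (map tst (lsubL (m + 0) N W))
      ≡⟨ cong (λ k → map (lams m) (map tst (lsubL k N W))) (+-identityʳ m) ⟩
    map (lams m) (map tst (lsubL m N (F ++ renderS m ss ++ R)))
      ≡⟨ cong (map (lams m) ∘′ map tst) (lsubL-closed-++ (renderS m ss ++ R) clF) ⟩
    map (lams m) (map tst (map (F ++_) (lsubL m N (renderS m ss ++ R))))
      ≡⟨ cong (map (lams m) ∘′ map tst ∘′ map (F ++_)) (lsubL-++-closed (renderS m ss) clR) ⟩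
    map (lams m) (map tst (map (F ++_) (map (_++ R) (lsubL m N (renderS m ss)))))
      ≡⟨ cong (map (lams m) ∘′ map tst ∘′ map (F ++_) ∘′ map (_++ R)) (lsubL-renderS m γ ss) ⟩
    map (lams m) (map tst (map (F ++_) (map (_++ R) (map (renderS m) (fillOne γ ss)))))
      ≡⟨ fuse (fillOne γ ss) ⟩
    map (frame m F R) (fillOne γ ss) ∎
    where
      open ≡-Reasoning
      N : Term
      N = plus γ
      W : Test
      W = F ++ renderS m ss ++ R
      fuse : ∀ Ss → map (lams m) (map tst (map (F ++_) (map (_++ R) (map (renderS m) Ss)))) ≡
                    map (frame m F R) Ss
      fuse [] = refl
      fuse (ss ∷ Ss) = cong (frame m F R ss ∷_) (fuse Ss)

  concatMap-lsub-frame : ∀ γ Ss →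
    concatMap (lsub 0 (plus γ)) (map (frame m F R) Ss) ≡ map (frame m F R) (concatMap (fillOne γ) Ss)
  concatMap-lsub-frame γ Ss = begin
    concatMap (lsub 0 (plus γ)) (map (frame m F R) Ss)     ≡⟨ concatMap-map (lsub 0 (plus γ)) (frame m F R) Ss ⟩
    concatMap (lsub 0 (plus γ) ∘′ frame m F R) Ss          ≡⟨ concatMap-cong (lsub-frame γ) Ss ⟩
    concatMap (map (frame m F R) ∘′ fillOne γ) Ss          ≡⟨ map-concatMap (frame m F R) (fillOne γ) Ss ⟨
    map (frame m F R) (concatMap (fillOne γ) Ss)           ∎
    where open ≡-Reasoning

  foldl-lsub-frame : ∀ a Ss →
    foldl (λ S L → concatMap (lsub 0 L) S) (map (frame m F R) Ss) (plusList a) ≡ map (frame m F R) (fillAll a Ss)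
  foldl-lsub-frame [] Ss = refl
  foldl-lsub-frame (γ ∷ a) Ss rewrite concatMap-lsub-frame γ Ss = foldl-lsub-frame a (concatMap (fillOne γ) Ss)

  occurs-frame : ∀ ss → occurs 0 (frame m F R ss) ≡ not (full ss)
  occurs-frame ss
    rewrite occurs-lams m {0} {tst (F ++ renderS m ss ++ R)} | +-identityʳ m
          | occursL-++ m F (renderS m ss ++ R) | occursL-++ m (renderS m ss) R
          | occursL-closed clF (≤-refl {m}) | occursL-closed clR (≤-refl {m})
          | occursL-renderS m ss = ∨-identityʳ (not (full ss))

  erase-frame : ∀ ss → erase 0 (frame m F R ss) ≡ (if full ss then frame m F R ss ∷ [] else [])
  erase-frame ss with full ss in full-ss | occurs-frame ss
  ... | true | occ rewrite occ =
    cong (_∷ []) (lower-closed (lams-closed₀ m (tst clW)))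
    where
      clW : All (Closed m) (F ++ renderS m ss ++ R)
      clW = Allₚ.++⁺ clF (Allₚ.++⁺ (renderS-closed m ss full-ss) clR)
  ... | false | occ rewrite occ = refl

  beta-frame : ∀ a ss →
    beta (frame m F R ss) (plusList a) ≡
    concatMap (λ ss′ → if full ss′ then frame m F R ss′ ∷ [] else []) (fillAll a (ss ∷ []))
  beta-frame a ss rewrite shiftL-closed (plusList-closed a {0}) | foldl-lsub-frame a (ss ∷ []) =
    ≡-trans (concatMap-map (erase 0) (frame m F R) (fillAll a (ss ∷ [])))
            (concatMap-cong erase-frame (fillAll a (ss ∷ [])))

  head-β : ∀ a ss Ps →
    τ⟨ apps (app (lam (frame m F R ss)) (plusList a)) Ps ⟩ ↠
    concatMap (λ ss′ → if full ss′ then τ⟨ apps (frame m F R ss′) Ps ⟩ else []) (fillAll a (ss ∷ []))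
  head-β a ss Ps =
    subst (τ⟨ apps (app (lam (frame m F R ss)) (plusList a)) Ps ⟩ ↠_) reduct (↠-term (⟶-apps Ps β))
    where
      open ≡-Reasoning
      Ss : List (List Slot)
      Ss = fillAll a (ss ∷ [])
      h : Term → Test
      h M = apps M Ps ∷ []
      reduct : map (_∷ []) (map (λ M → apps M Ps) (beta (frame m F R ss) (plusList a))) ≡
               concatMap (λ ss′ → if full ss′ then h (frame m F R ss′) ∷ [] else []) Ss
      reduct = begin
        map (_∷ []) (map (λ M → apps M Ps) (beta (frame m F R ss) (plusList a)))
          ≡⟨ sym (map-∘ _) ⟩
        map h (beta (frame m F R ss) (plusList a))
          ≡⟨ cong (map h) (beta-frame a ss) ⟩
        map h (concatMap (λ ss′ → if full ss′ then frame m F R ss′ ∷ [] else []) Ss)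
          ≡⟨ map-concatMap h _ Ss ⟩
        concatMap (λ ss′ → map h (if full ss′ then frame m F R ss′ ∷ [] else [])) Ss
          ≡⟨ concatMap-cong (λ ss′ → map-if h (full ss′) (frame m F R ss′)) Ss ⟩
        concatMap (λ ss′ → if full ss′ then h (frame m F R ss′) ∷ [] else []) Ss ∎

τ̄-applied-vanishes : ∀ V a as → Trimmed (a ∷ as) → Vanishes (apps (tst V) (map plusList (a ∷ as)) ∷ [])
τ̄-applied-vanishes V (γ ∷ a) [] last = ↠-term τ̄-cons
τ̄-applied-vanishes V (γ ∷ a) (a′ ∷ as) (cons _) = ↠-term (⟶-apps (map plusList (a′ ∷ as)) τ̄-cons)
τ̄-applied-vanishes V [] (a′ ∷ as) (cons t) =
  ↠-term (⟶-apps (map plusList (a′ ∷ as)) τ̄-nil) ◅◅ τ̄-applied-vanishes V a′ as t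

erase-lams : ∀ m {W} → All (Closed (suc m)) W →
             erase 0 (lams m (tst W)) ≡ (if occursL m W then [] else lams m (tst W) ∷ [])
erase-lams m {W} clW rewrite occurs-lams m {0} {tst W} | +-identityʳ m with occursL m W in occ
... | true = refl
... | false = cong (_∷ []) (lower-closed (lams-closed₀ m (tst (strengthenL clW occ))))

τλ-lams : ∀ m {W} → All (Closed (suc m)) W →
          τ⟨ lams (suc m) (tst W) ⟩ ↠ map (_∷ []) (if occursL m W then [] else lams m (tst W) ∷ [])
τλ-lams m {W} clW =
  subst (τ⟨ lams (suc m) (tst W) ⟩ ↠_) (cong (map (_∷ [])) (erase-lams m clW)) (↠-step (τλ [] []))

-- Erasing the bound variables one by one hits the one that occurs.
lams-vanishes : ∀ m {W} j → j ≤ m → occursL j W ≡ true → All (Closed (suc m)) W →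
                Vanishes (lams (suc m) (tst W) ∷ [])
lams-vanishes m {W} j j≤m occ clW with occursL m W in occ-m | τλ-lams m clW
... | true | step₁ = step₁
... | false | step₁ with m≤n⇒m<n∨m≡n j≤m
...   | inj₁ (s≤s j≤m′) = step₁ ◅◅ lams-vanishes _ j j≤m′ occ (strengthenL clW occ-m)
...   | inj₂ refl = contradiction (≡-trans (sym occ) occ-m) λ ()

-- The first group of plusBody r i bs refers to the variable of index r ∸ i;
-- aligned, this index is the number of binders still to come.
Aligned : ℕ → ℕ → List (List D) → Set
Aligned r i [] = ⊤
Aligned r i (b ∷ bs) = r ∸ i ≡ length bs

Aligned-tail : ∀ r i b bs → Aligned r i (b ∷ bs) → Aligned r (suc i) bs
Aligned-tail r i b [] _ = tt
Aligned-tail r i b (b′ ∷ bs) aligned = ≡-trans (sym (pred[m∸n]≡m∸[1+n] r i)) (cong pred aligned)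

Aligned-initial : ∀ bs → Aligned (length bs) 1 bs
Aligned-initial [] = tt
Aligned-initial (b ∷ bs) = refl

plusBody-closed-aligned : ∀ r i bs → Aligned r i bs → All (Closed (length bs)) (plusBody r i bs)
plusBody-closed-aligned r i [] _ = []
plusBody-closed-aligned r i (b ∷ bs) aligned =
  subst (λ k → All (Closed (suc k)) (plusBody r i (b ∷ bs))) aligned (plusBody-closed r i (b ∷ bs))

plusBody-mentions-last : ∀ r i b bs → Trimmed (b ∷ bs) → Aligned r i (b ∷ bs) →
                         occursL 0 (plusBody r i (b ∷ bs)) ≡ true
plusBody-mentions-last r i (δ ∷ b) [] last aligned
  rewrite occursL-++ 0 (minusList r i (δ ∷ b)) [] | occursL-++ 0 (minus δ (var (r ∸ i))) (minusList r i b)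
        | aligned | occursL-minus-hole 0 δ = refl
plusBody-mentions-last r i b (b′ ∷ bs) (cons t) aligned
  rewrite occursL-++ 0 (minusList r i b) (plusBody r (suc i) (b′ ∷ bs))
        | plusBody-mentions-last r (suc i) b′ bs t (Aligned-tail r i b (b′ ∷ bs) aligned) =
  ∨-zeroʳ (occursL 0 (minusList r i b))

-- An assignment fills, group by group, every hole β_{i,j}⁻[xᵢ] with one of the
-- elements of the i-th bag, each element being used exactly once.
assignments : List (List D) → List (List D) → List (List (List Slot))
assignments [] [] = [] ∷ []
assignments [] (_ ∷ _) = []
assignments (_ ∷ _) [] = []
assignments (b ∷ bs) (a ∷ as) =
  concatMap (λ ss → if full ss then map (ss ∷_) (assignments bs as) else []) (fillAll a (holes b ∷ []))

renderA : List (List Slot) → Test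
renderA = concatMap (renderS 0)

renderA-cons : ∀ F x ss → full ss ≡ true →
               ∀ A → (F ++ renderS x ss) ++ renderA A ≡ F ++ renderA (ss ∷ A)
renderA-cons F x ss full-ss A =
  ≡-trans (++-assoc F (renderS x ss) (renderA A)) (cong (λ V → F ++ V ++ renderA A) (renderS-full x ss full-ss))

frame-holes : ∀ r i F b bs → Aligned r i (b ∷ bs) →
              frame (length bs) F (plusBody r (suc i) bs) (holes b) ≡
              lams (length bs) (tst (F ++ plusBody r i (b ∷ bs)))
frame-holes r i F b bs aligned =
  cong (λ V → lams (length bs) (tst (F ++ V ++ plusBody r (suc i) bs)))
       (sym (≡-trans (minusList≡renderS-holes r i b) (cong (λ k → renderS k (holes b)) aligned)))

applied-↠-assignments : ∀ r i F bs as → All (Closed 0) F → Aligned r i bs → Trimmed bs → Trimmed as →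
  τ⟨ apps (lams (length bs) (tst (F ++ plusBody r i bs))) (map plusList as) ⟩ ↠
  map (λ A → F ++ renderA A) (assignments bs as)
applied-↠-assignments r i F [] [] _ _ _ _ =
  subst (τ⟨ tst (F ++ []) ⟩ ↠_) (cong (_∷ []) (++-identityʳ (F ++ []))) (↠-step (ττ̄ [] []))
applied-↠-assignments r i F [] (a ∷ as) _ _ _ ta = τ̄-applied-vanishes (F ++ []) a as ta
applied-↠-assignments r i F (b ∷ bs) [] clF aligned tb _ =
  lams-vanishes (length bs) 0 z≤n mentions
    (Allₚ.++⁺ (weakenL z≤n clF) (plusBody-closed-aligned r i (b ∷ bs) aligned))
  where
    mentions : occursL 0 (F ++ plusBody r i (b ∷ bs)) ≡ true
    mentions rewrite occursL-++ 0 F (plusBody r i (b ∷ bs)) | occursL-closed {y = 0} clF z≤n =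
      plusBody-mentions-last r i b bs tb aligned
applied-↠-assignments r i F (b ∷ bs) (a ∷ as) clF aligned tb ta =
  subst₂ _↠_ (cong (λ M → τ⟨ apps (app (lam M) (plusList a)) Ps ⟩) (frame-holes r i F b bs aligned))
    (sym (map-concatMap _ filled (fillAll a (holes b ∷ []))))
    (head-β (weakenL z≤n clF) clR a (holes b) Ps ◅◅ ↠-concatMap _ _ continue (fillAll a (holes b ∷ [])))
  where
    m : ℕ
    m = length bs
    R : Test
    R = plusBody r (suc i) bs
    Ps : List Bag
    Ps = map plusList as
    clR : All (Closed m) R
    clR = plusBody-closed-aligned r (suc i) bs (Aligned-tail r i b bs aligned)
    filled : List Slot → List (List (List Slot))
    filled ss = if full ss then map (ss ∷_) (assignments bs as) else []
    continue : ∀ ss → (if full ss then τ⟨ apps (frame m F R ss) Ps ⟩ else []) ↠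
                      map (λ A → F ++ renderA A) (filled ss)
    continue ss with full ss in full-ss
    ... | false = ↠-refl
    ... | true =
      subst₂ _↠_ (cong (λ W → τ⟨ apps (lams m (tst W)) Ps ⟩) (++-assoc F (renderS m ss) R))
        (≡-trans (map-cong (renderA-cons F m ss full-ss) (assignments bs as)) (map-∘ (assignments bs as)))
        (applied-↠-assignments r (suc i) (F ++ renderS m ss) bs as (Allₚ.++⁺ clF (renderS-closed m ss full-ss))
          (Aligned-tail r i b bs aligned) (Trimmed-tail tb) (Trimmed-tail ta))

minus-plus-↠-assignments : ∀ as bs →
  (minus (mk as) (plus (mk bs)) ∷ []) ↠ map renderA (assignments (trim bs) (trim as))
minus-plus-↠-assignments as bs =
  subst (λ M → τ⟨ M ⟩ ↠ map renderA (assignments (trim bs) (trim as))) term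
    (applied-↠-assignments (length (trim bs)) 1 [] (trim bs) (trim as) [] (Aligned-initial (trim bs))
      (trim-Trimmed bs) (trim-Trimmed as))
  where
    term : apps (lams (length (trim bs)) (tst (plusBody (length (trim bs)) 1 (trim bs)))) (map plusList (trim as)) ≡
           apps (lams (len bs) (tst (plusBody (len bs) 1 bs))) (bags (len as) as)
    term rewrite length-trim bs | plusBody-trim (len bs) 1 bs | bags-take (len as) as = refl

data Filling : List Slot → List Slot → List D → Set where
  []   : Filling [] [] []
  keep : ∀ {s ss ss′ cs} → Filling ss ss′ cs → Filling (s ∷ ss) (s ∷ ss′) cs
  fill : ∀ {δ γ ss ss′ cs} → Filling ss ss′ cs →
         Filling ((δ , nothing) ∷ ss) ((δ , just γ) ∷ ss′) (γ ∷ cs)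

filledWith : List D → List D → List Slot
filledWith = zipWith (λ δ γ → δ , just γ)

Filling-refl : ∀ ss → Filling ss ss []
Filling-refl [] = []
Filling-refl (s ∷ ss) = keep (Filling-refl ss)

Filling-[] : ∀ {ss ss′} → Filling ss ss′ [] → ss′ ≡ ss
Filling-[] [] = refl
Filling-[] (keep f) = cong (_ ∷_) (Filling-[] f)

Filling-trans : ∀ {ss ss₁ ss₂ cs₁ cs₂} → Filling ss ss₁ cs₁ → Filling ss₁ ss₂ cs₂ →
                ∃ λ cs → Filling ss ss₂ cs × cs ↭ cs₁ ++ cs₂
Filling-trans [] [] = [] , [] , ↭-refl′
Filling-trans (keep f₁) (keep f₂) with Filling-trans f₁ f₂
... | cs , f , p = cs , keep f , p
Filling-trans {cs₁ = cs₁} (keep f₁) (fill {γ = γ} {cs = cs₂} f₂) with Filling-trans f₁ f₂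
... | cs , f , p = γ ∷ cs , fill f , ↭-trans (prep γ p) (↭-sym (↭-shift γ cs₁ cs₂))
Filling-trans (fill {γ = γ} f₁) (keep f₂) with Filling-trans f₁ f₂
... | cs , f , p = γ ∷ cs , fill f , prep γ p

fillOne-Filling : ∀ γ ss {ss′} → ss′ ∈ fillOne γ ss → Filling ss ss′ (γ ∷ [])
fillOne-Filling γ ((δ , nothing) ∷ ss) (here refl) = fill (Filling-refl ss)
fillOne-Filling γ ((δ , nothing) ∷ ss) (there ss′∈) with ∈-map⁻ ((δ , nothing) ∷_) ss′∈
... | ss₁ , ss₁∈ , refl = keep (fillOne-Filling γ ss ss₁∈)
fillOne-Filling γ ((δ , just γ′) ∷ ss) ss′∈ with ∈-map⁻ ((δ , just γ′) ∷_) ss′∈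
... | ss₁ , ss₁∈ , refl = keep (fillOne-Filling γ ss ss₁∈)

fillAll-Filling : ∀ a Ss {ss′} → ss′ ∈ fillAll a Ss →
                  ∃ λ ss → ss ∈ Ss × ∃ λ cs → Filling ss ss′ cs × cs ↭ a
fillAll-Filling [] Ss {ss′} ss′∈ = ss′ , ss′∈ , [] , Filling-refl ss′ , ↭-refl′
fillAll-Filling (γ ∷ a) Ss ss′∈ with fillAll-Filling a (concatMap (fillOne γ) Ss) ss′∈
... | ss₁ , ss₁∈ , cs₂ , f₂ , p₂ with find (∈-concatMap⁻ (fillOne γ) {xs = Ss} ss₁∈)
... | ss , ss∈ , ss₁∈′ with Filling-trans (fillOne-Filling γ ss ss₁∈′) f₂
... | cs , f , p = ss , ss∈ , cs , f , ↭-trans p (prep γ p₂)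

Filling-split : ∀ {ss ss′ cs} γ cs₁ cs₂ → Filling ss ss′ cs → cs ≡ cs₁ ++ γ ∷ cs₂ →
                ∃ λ ss₁ → ss₁ ∈ fillOne γ ss × Filling ss₁ ss′ (cs₁ ++ cs₂)
Filling-split γ [] cs₂ [] ()
Filling-split γ (_ ∷ _) cs₂ [] ()
Filling-split γ cs₁ cs₂ (keep {s = δ , nothing} f) eq with Filling-split γ cs₁ cs₂ f eq
... | ss₁ , ss₁∈ , f′ = (δ , nothing) ∷ ss₁ , there (∈-map⁺ ((δ , nothing) ∷_) ss₁∈) , keep f′
Filling-split γ cs₁ cs₂ (keep {s = δ , just γ′} f) eq with Filling-split γ cs₁ cs₂ f eq
... | ss₁ , ss₁∈ , f′ = (δ , just γ′) ∷ ss₁ , ∈-map⁺ ((δ , just γ′) ∷_) ss₁∈ , keep f′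
Filling-split γ [] cs₂ (fill {δ = δ} {ss = ss} f) refl = (δ , just γ) ∷ ss , here refl , keep f
Filling-split γ (_ ∷ cs₁) cs₂ (fill {δ = δ} f) refl with Filling-split γ cs₁ cs₂ f refl
... | ss₁ , ss₁∈ , f′ = (δ , nothing) ∷ ss₁ , there (∈-map⁺ ((δ , nothing) ∷_) ss₁∈) , fill f′

Filling⇒∈fillAll : ∀ a {Ss ss ss′ cs} → ss ∈ Ss → Filling ss ss′ cs → cs ↭ a →
                   ss′ ∈ fillAll a Ss
Filling⇒∈fillAll [] ss∈ f p rewrite ↭-empty-inv p | Filling-[] f = ss∈
Filling⇒∈fillAll (γ ∷ a) {Ss} {ss} ss∈ f p with ∈-∃++ (∈-resp-↭ (↭-sym p) (here refl))
... | cs₁ , cs₂ , refl with Filling-split γ cs₁ cs₂ f refl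
... | ss₁ , ss₁∈ , f′ =
  Filling⇒∈fillAll a (∈-concatMap⁺ (fillOne γ) {xs = Ss} (lose ss∈ ss₁∈)) f′ (drop-mid cs₁ [] p)

Filling-holes-full : ∀ b {ss′ cs} → Filling (holes b) ss′ cs → full ss′ ≡ true →
                     ss′ ≡ filledWith b cs × length cs ≡ length b
Filling-holes-full [] [] _ = refl , refl
Filling-holes-full (δ ∷ b) (fill {γ = γ} f) full-ss′ with Filling-holes-full b f full-ss′
... | refl , len = refl , cong suc len

Filling-holes : ∀ b cs → length cs ≡ length b → Filling (holes b) (filledWith b cs) cs
Filling-holes [] [] _ = []
Filling-holes (δ ∷ b) (γ ∷ cs) len = fill (Filling-holes b cs (cong pred len))

full-filledWith : ∀ b cs → full (filledWith b cs) ≡ true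
full-filledWith [] cs = refl
full-filledWith (δ ∷ b) [] = refl
full-filledWith (δ ∷ b) (γ ∷ cs) = full-filledWith b cs

full-filling : ∀ a b {ss} → ss ∈ fillAll a (holes b ∷ []) → full ss ≡ true →
               ∃ λ cs → ss ≡ filledWith b cs × length cs ≡ length b × cs ↭ a
full-filling a b ss∈ full-ss with fillAll-Filling a (holes b ∷ []) ss∈
... | _ , here refl , cs , f , p with Filling-holes-full b f full-ss
... | eq , len = cs , eq , len , p

filling-complete : ∀ a b cs → length cs ≡ length b → cs ↭ a → filledWith b cs ∈ fillAll a (holes b ∷ [])
filling-complete a b cs len p = Filling⇒∈fillAll a (here refl) (Filling-holes b cs len) p

Matched : Slot → Set
Matched (δ , nothing) = ⊥
Matched (δ , just γ) = δ ≐ γ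

Good Bad : Slot → Set
Good s = Matched s × Succeeds (renderSlot 0 s)
Bad s = ¬ Matched s × Vanishes (renderSlot 0 s)

Outcome : D → D → Set
Outcome δ γ = Good (δ , just γ) ⊎ Bad (δ , just γ)

∈-if⁻ : ∀ {X : Set} b {x : X} {xs} → x ∈ (if b then xs else []) → b ≡ true × x ∈ xs
∈-if⁻ true x∈ = refl , x∈

∈-if⁺ : ∀ {X : Set} {b} {x : X} {xs} → b ≡ true → x ∈ xs → x ∈ (if b then xs else [])
∈-if⁺ refl x∈ = x∈

any-or-all : ∀ {X : Set} {P Q : X → Set} {xs} → All (λ x → P x ⊎ Q x) xs → Any P xs ⊎ All Q xs
any-or-all [] = inj₂ []
any-or-all (inj₁ p ∷ _) = inj₁ (here p)
any-or-all (inj₂ q ∷ pqs) with any-or-all pqs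
... | inj₁ ps = inj₁ (there ps)
... | inj₂ qs = inj₂ (q ∷ qs)

GoodOrBad : List (List Slot) → Set
GoodOrBad A = All (All Good) A ⊎ Any (Any Bad) A

good-succeeds : ∀ A → All (All Good) A → Succeeds (renderA A)
good-succeeds A good =
  concat-succeeds (Allₚ.map⁺ (All.map (concat-succeeds ∘′ Allₚ.map⁺ ∘′ All.map proj₂) good))

bad-vanishes : ∀ A → Any (Any Bad) A → Vanishes (renderA A)
bad-vanishes A bad =
  concat-vanishes (Anyₚ.map⁺ (Any.map (concat-vanishes ∘′ Anyₚ.map⁺ ∘′ Any.map proj₂) bad))

matched-bad-⊥ : ∀ {A} → All (All Matched) A → ¬ Any (Any Bad) A
matched-bad-⊥ matched bad = Allₚ.Any¬⇒¬All (Any.map (Allₚ.Any¬⇒¬All ∘′ Any.map proj₁) bad) matched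

filledWith-outcome : ∀ b cs → (∀ {δ γ} → δ ∈ b → γ ∈ cs → Outcome δ γ) →
                     All Good (filledWith b cs) ⊎ Any Bad (filledWith b cs)
filledWith-outcome [] cs _ = inj₁ []
filledWith-outcome (δ ∷ b) [] _ = inj₁ []
filledWith-outcome (δ ∷ b) (γ ∷ cs) ih with ih (here refl) (here refl)
                                         | filledWith-outcome b cs (λ δ∈ γ∈ → ih (there δ∈) (there γ∈))
... | inj₂ bad | _ = inj₂ (here bad)
... | inj₁ good | inj₁ goods = inj₁ (good ∷ goods)
... | inj₁ good | inj₂ bads = inj₂ (there bads)

assignments-outcome : ∀ bs as → (∀ {δ γ} → δ ∈ concat bs → γ ∈ concat as → Outcome δ γ) →
                      All GoodOrBad (assignments bs as)
assignments-outcome [] [] _ = inj₁ [] ∷ []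
assignments-outcome [] (_ ∷ _) _ = []
assignments-outcome (_ ∷ _) [] _ = []
assignments-outcome (b ∷ bs) (a ∷ as) ih =
  Allₚ.concat⁺ (Allₚ.map⁺ (All.tabulate per-filling))
  where
    rest : All GoodOrBad (assignments bs as)
    rest = assignments-outcome bs as (λ δ∈ γ∈ → ih (∈-++⁺ʳ b δ∈) (∈-++⁺ʳ a γ∈))
    per-filling : ∀ {ss} → ss ∈ fillAll a (holes b ∷ []) →
                  All GoodOrBad (if full ss then map (ss ∷_) (assignments bs as) else [])
    per-filling {ss} ss∈ with full ss in full-ss
    ... | false = []
    ... | true with full-filling a b ss∈ full-ss
    ... | cs , refl , _ , cs↭a =
      Allₚ.map⁺ (All.map (combine (filledWith-outcome b cs pair-outcome)) rest)
      where
        pair-outcome : ∀ {δ γ} → δ ∈ b → γ ∈ cs → Outcome δ γ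
        pair-outcome δ∈ γ∈ = ih (∈-++⁺ˡ δ∈) (∈-++⁺ˡ (∈-resp-↭ cs↭a γ∈))
        combine : ∀ {A} → All Good ss ⊎ Any Bad ss → GoodOrBad A → GoodOrBad (ss ∷ A)
        combine (inj₁ goods) (inj₁ goods′) = inj₁ (goods ∷ goods′)
        combine (inj₁ _) (inj₂ bads) = inj₂ (there bads)
        combine (inj₂ bads) _ = inj₂ (here bads)

matched⇒Pointwise : ∀ b cs → All Matched (filledWith b cs) → length cs ≡ length b → Pointwise _≐_ b cs
matched⇒Pointwise [] [] _ _ = []
matched⇒Pointwise (δ ∷ b) (γ ∷ cs) (δ≐γ ∷ matched) len =
  δ≐γ ∷ matched⇒Pointwise b cs matched (cong pred len)

Pointwise⇒matched : ∀ {b cs} → Pointwise _≐_ b cs → All Matched (filledWith b cs)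
Pointwise⇒matched [] = []
Pointwise⇒matched (δ≐γ ∷ pw) = δ≐γ ∷ Pointwise⇒matched pw

assignments-sound : ∀ bs as {A} → A ∈ assignments bs as → All (All Matched) A → Pointwise _≈ᴹ_ bs as
assignments-sound [] [] _ _ = []
assignments-sound (b ∷ bs) (a ∷ as) A∈ matched
  with find (∈-concatMap⁻ _ {xs = fillAll a (holes b ∷ [])} A∈)
... | ss , ss∈ , A∈′ with ∈-if⁻ (full ss) A∈′
... | full-ss , A∈″ with ∈-map⁻ (ss ∷_) A∈″ | full-filling a b ss∈ full-ss
... | A′ , A′∈ , refl | cs , refl , len , cs↭a with matched
... | m ∷ ms =
  trans (Pointwise⇒≈ᴹ (matched⇒Pointwise b cs m len)) (↭⇒≈ᴹ cs↭a) ∷ assignments-sound bs as A′∈ ms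

assignments-complete : ∀ {bs as} → Pointwise _≈ᴹ_ bs as →
                       ∃ λ A → A ∈ assignments bs as × All (All Matched) A
assignments-complete [] = [] , here refl , []
assignments-complete {b ∷ bs} {a ∷ as} (b≈a ∷ pw) with ≈ᴹ⇒Pointwise-↭ b≈a | assignments-complete pw
... | cs , a↭cs , b≐cs | A , A∈ , matched =
  filledWith b cs ∷ A ,
  ∈-concatMap⁺ _ {xs = fillAll a (holes b ∷ [])}
    (lose (filling-complete a b cs (sym (Pointwise-length b≐cs)) (↭-sym a↭cs))
          (∈-if⁺ (full-filledWith b cs) (∈-map⁺ (filledWith b cs ∷_) A∈))) ,
  Pointwise⇒matched b≐cs ∷ matched

outcome-mk : ∀ as bs → (∀ {δ γ} → δ ∈ concat (trim bs) → γ ∈ concat (trim as) → Outcome δ γ) →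
             Outcome (mk as) (mk bs)
outcome-mk as bs ih = decide (any-or-all outcomes)
  where
    As : List (List (List Slot))
    As = assignments (trim bs) (trim as)
    outcomes : All GoodOrBad As
    outcomes = assignments-outcome (trim bs) (trim as) ih
    decide : Any (All (All Good)) As ⊎ All (Any (Any Bad)) As → Outcome (mk as) (mk bs)
    decide (inj₁ some-good) with find some-good
    ... | A , A∈ , good = inj₁ (equal , succeeds)
      where
        equal : mk as ≐ mk bs
        equal = Pointwise-trim⇒≐ (Pointwise.symmetric ≈ᴹ-sym
                  (assignments-sound (trim bs) (trim as) A∈ (All.map (All.map proj₁) good)))
        succeeds : Succeeds (minus (mk as) (plus (mk bs)))
        succeeds = minus-plus-↠-assignments as bs ◅◅
          one-succeeds (Allₚ.map⁺ (All.map [ inj₁ ∘′ good-succeeds _ , inj₂ ∘′ bad-vanishes _ ] outcomes))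
                       (Anyₚ.map⁺ (Any.map (good-succeeds _) some-good))
    decide (inj₂ all-bad) =
      inj₂ (unequal ,
            minus-plus-↠-assignments as bs ◅◅ all-vanish (Allₚ.map⁺ (All.map (bad-vanishes _) all-bad)))
      where
        unequal : ¬ mk as ≐ mk bs
        unequal eq with assignments-complete (Pointwise.symmetric ≈ᴹ-sym (≐⇒Pointwise-trim eq))
        ... | A , A∈ , matched = matched-bad-⊥ matched (All.lookup all-bad A∈)

-- The recursive calls swap the roles of α and β, so both are proved together.
Decided : D → Set
Decided γ = (∀ δ → Outcome γ δ) × (∀ δ → Outcome δ γ)

mutual
  decided : ∀ γ → Decided γ
  decided (mk as) = (λ { (mk bs) → outcome-mk as bs (λ _ γ∈ → proj₂ (lookup γ∈) _) }) ,
                    (λ { (mk bs) → outcome-mk bs as (λ δ∈ _ → proj₁ (lookup δ∈) _) })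
    where
      lookup : ∀ {γ} → γ ∈ concat (trim as) → Decided γ
      lookup = All.lookup (Allₚ.concat⁺ (Allₚ.take⁺ (len as) (decided-groups as)))

  decided-groups : ∀ as → All (All Decided) as
  decided-groups [] = []
  decided-groups (a ∷ as) = decided-group a ∷ decided-groups as

  decided-group : ∀ a → All Decided a
  decided-group [] = []
  decided-group (γ ∷ a) = decided γ ∷ decided-group a

corollary5p7 : (α β : D) →
    (α ≐ β → (minus α (plus β) ∷ []) ↠ (ε ∷ [])) ×
    (¬ (α ≐ β) → (minus α (plus β) ∷ []) ↠ [])
corollary5p7 α δ with proj₁ (decided α) δ
... | inj₁ (α≐δ , succeeds) = (λ _ → succeeds) , (λ α≉δ → contradiction α≐δ α≉δ)
... | inj₂ (α≉δ , vanishes) = (λ α≐δ → contradiction α≐δ α≉δ) , (λ _ → vanishes)
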